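{- Let $\mu,\nu,q\in\mathbb{C}$ and let $X,Y$ satisfy $XY-qYX=\mu I+\nu Y$. Let $S_{\mu,\nu;q}(n;j,k)$ be the coefficient of $Y^jX^k$ in the normal ordered expansion $(YX)^n=\sum_{j,k\ge0}S_{\mu,\nu;q}(n;j,k)Y^jX^k$, with $S_{\mu,\nu;q}(n;j,k)=0$ if $j<0$ or $k<0$. Then for all $n\ge0$, $j\ge1$, $k\ge0$, $$S_{\mu,\nu;q}(n+1;j,k)=q^{j-1}S_{\mu,\nu;q}(n;j-1,k-1)+\mu[j]_q\,S_{\mu,\nu;q}(n;j,k)+\nu[j-1]_q\,S_{\mu,\nu;q}(n;j-1,k).$$
   Context: The monomials $Y^jX^k$ form a basis of this algebra, so the coefficients are well defined. $[m]_q=1+q+\cdots+q^{m-1}$ for $m\ge1$ and $[0]_q=0$. -}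

module Defs where

open import Level using (Level)
open import Algebra.Bundles using (CommutativeRing)
open import Data.Nat using (ℕ; zero; suc; _≟_)
open import Data.Integer using (ℤ; +_; -[1+_])
open import Data.List using (List; []; _∷_; _++_; map; concatMap)
open import Data.Product using (_×_; _,_)
open import Relation.Nullary using (yes; no)

-- Normal ordering in the algebra generated by X, Y with
--   X Y - q Y X = μ I + ν Y,
-- over a commutative coefficient ring R (standing in for ℂ).
-- An element in normal ordered form is represented by a finite list of
-- terms (c , j , k) meaning  c · Y^j X^k ; its coefficient at Y^j X^k is
-- the sum of the c's of the matching terms.
module NormalOrder {c ℓ : Level} (R : CommutativeRing c ℓ)
                   (μ ν q : CommutativeRing.Carrier R) where
  open CommutativeRing R

  Term : Set c
  Term = Carrier × ℕ × ℕ

  Poly : Set c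
  Poly = List Term

  pow : Carrier → ℕ → Carrier
  pow a zero    = 1#
  pow a (suc m) = a * pow a m

  qint : ℕ → Carrier
  qint zero    = 0#
  qint (suc m) = 1# + q * qint m

  scale : Carrier → Poly → Poly
  scale a = map (λ { (b , j , k) → (a * b , j , k) })

  mulYˡ : Poly → Poly
  mulYˡ = map (λ { (b , j , k) → (b , suc j , k) })

  mulXʳ : ℕ → Poly → Poly
  mulXʳ m = map (λ { (b , j , k) → (b , j , k Data.Nat.+ m) })

  -- normal ordered form of X Y^j, computed by the defining relation:
  --   X Y^(j+1) = (X Y) Y^j = q Y (X Y^j) + μ Y^j + ν Y^(j+1)
  XYpow : ℕ → Poly
  XYpow zero    = (1# , 0 , 1) ∷ []
  XYpow (suc j) = scale q (mulYˡ (XYpow j)) ++ ((μ , j , 0) ∷ (ν , suc j , 0) ∷ [])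

  mulXˡ : Poly → Poly
  mulXˡ = concatMap (λ { (b , j , k) → scale b (mulXʳ k (XYpow j)) })

  YXpow : ℕ → Poly
  YXpow zero    = (1# , 0 , 0) ∷ []
  YXpow (suc n) = mulYˡ (mulXˡ (YXpow n))

  coeff : Poly → ℕ → ℕ → Carrier
  coeff []                  j k = 0#
  coeff ((b , j' , k') ∷ p) j k with j' ≟ j | k' ≟ k
  ... | yes _ | yes _ = b + coeff p j k
  ... | _     | _     = coeff p j k

  S : ℕ → ℤ → ℤ → Carrier
  S n (+ j)    (+ k)    = coeff (YXpow n) j k
  S n (+ j)    -[1+ _ ] = 0#
  S n -[1+ _ ] _        = 0#

-- (YX)^(n+1) = Y · X (YX)^n. Induction on j turns the defining relation into the closed form
-- X Y^j = q^j Y^j X + μ [j]_q Y^(j-1) + ν [j]_q Y^j, so X · Y^i X^k contributes q^i to Y^i X^(k+1),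
-- μ [i]_q to Y^(i-1) X^k and ν [i]_q to Y^i X^k. Summing over the terms of (YX)^n, the coefficient
-- of Y^(j-1) X^k in X (YX)^n is therefore q^(j-1) S(n; j-1, k-1) + μ [j]_q S(n; j, k) + ν [j-1]_q S(n; j-1, k),
-- and left multiplication by Y only moves it to Y^j X^k. Coefficients are written as sums of
-- Kronecker deltas, under which multiplication by Y or by a power of X is an injective reindexing.
module Submission where

open import Defs
open import Algebra.Bundles using (CommutativeRing)
open import Data.Nat using (ℕ; zero; suc; _≤_; _∸_; _≟_; _≤?_; s≤s) renaming (_+_ to _+ℕ_)
import Data.Nat.Properties as ℕₚ
open import Data.Integer using (+_) renaming (_-_ to _-ℤ_)
open import Data.List using ([]; _∷_; _++_; map)
open import Data.Product using (_×_; _,_; ∃; proj₂)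
open import Data.Product.Properties using (≡-dec; ×-≡,≡←≡)
open import Data.Sum using (_⊎_; inj₁; inj₂)
open import Function using (_∘_)
open import Function.Definitions using (Injective)
open import Relation.Binary.Definitions using (DecidableEquality)
open import Relation.Nullary using (yes; no; contradiction)
import Relation.Binary.PropositionalEquality as ≡
open ≡ using (_≡_; _≢_)

module NormalOrderProperties {c ℓ} (R : CommutativeRing c ℓ) (μ ν q : CommutativeRing.Carrier R) where
  open CommutativeRing R
  open NormalOrder R μ ν q
  open import Algebra.Solver.Ring.NaturalCoefficients.Default commutativeSemiring
    using (solve; _:=_; _:+_; _:*_; con)
  open import Relation.Binary.Reasoning.Setoid setoid

  Index : Set
  Index = ℕ × ℕ

  _≟ᵢ_ : DecidableEquality Index
  _≟ᵢ_ = ≡-dec _≟_ _≟_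

  coeffAt : Poly → Index → Carrier
  coeffAt p (j , k) = coeff p j k

  infix 4 _≋_
  record _≋_ (p r : Poly) : Set ℓ where
    constructor mk≋
    field coeffAt-≈ : ∀ x → coeffAt p x ≈ coeffAt r x
  open _≋_

  ≋-trans : ∀ {p r s} → p ≋ r → r ≋ s → p ≋ s
  ≋-trans p≋r r≋s = mk≋ λ x → trans (coeffAt-≈ p≋r x) (coeffAt-≈ r≋s x)

  -- The same case split as in coeff, so that coeffAt-∷ is proved by one with-abstraction.
  δ : Index → Index → Carrier
  δ (j' , k') (j , k) with j' ≟ j | k' ≟ k
  ... | yes _ | yes _ = 1#
  ... | _     | _     = 0#

  δ-diag : ∀ x → δ x x ≡ 1#
  δ-diag (j , k) with j ≟ j | k ≟ k
  ... | yes _  | yes _  = ≡.refl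
  ... | yes _  | no k≢k = contradiction ≡.refl k≢k
  ... | no j≢j | _      = contradiction ≡.refl j≢j

  δ-≢ : ∀ {i x} → i ≢ x → δ i x ≡ 0#
  δ-≢ {j' , k'} {j , k} i≢x with j' ≟ j | k' ≟ k
  ... | yes ≡.refl | yes ≡.refl = contradiction ≡.refl i≢x
  ... | yes _      | no _       = ≡.refl
  ... | no _       | _          = ≡.refl

  δ-injective : ∀ {g : Index → Index} → Injective _≡_ _≡_ g → ∀ i x → δ (g i) (g x) ≡ δ i x
  δ-injective {g} g-inj i x with i ≟ᵢ x
  ... | yes ≡.refl = ≡.trans (δ-diag (g i)) (≡.sym (δ-diag i))
  ... | no i≢x     = ≡.trans (δ-≢ (i≢x ∘ g-inj)) (≡.sym (δ-≢ i≢x))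

  δ-transport : ∀ (f : Index → Carrier) i x → f i * δ i x ≈ f x * δ i x
  δ-transport f i x with i ≟ᵢ x
  ... | yes ≡.refl = refl
  ... | no i≢x rewrite δ-≢ i≢x = trans (zeroʳ (f i)) (sym (zeroʳ (f x)))

  coeffAt-∷ : ∀ b i p x → coeffAt ((b , i) ∷ p) x ≈ b * δ i x + coeffAt p x
  coeffAt-∷ b (j' , k') p (j , k) with j' ≟ j | k' ≟ k
  ... | yes _ | yes _ = +-congʳ (sym (*-identityʳ b))
  ... | yes _ | no _  = sym (trans (+-congʳ (zeroʳ b)) (+-identityˡ _))
  ... | no _  | _     = sym (trans (+-congʳ (zeroʳ b)) (+-identityˡ _))

  -- On a concrete list Σδ computes to a ring expression in the deltas.
  Σδ : Poly → Index → Carrier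
  Σδ []            x = 0#
  Σδ ((b , i) ∷ p) x = b * δ i x + Σδ p x

  coeffAt-Σδ : ∀ p x → coeffAt p x ≈ Σδ p x
  coeffAt-Σδ []            x = refl
  coeffAt-Σδ ((b , i) ∷ p) x = trans (coeffAt-∷ b i p x) (+-congˡ (coeffAt-Σδ p x))

  ≋-by-Σδ : ∀ {p r} → (∀ x → Σδ p x ≈ Σδ r x) → p ≋ r
  ≋-by-Σδ {p} {r} eq = mk≋ λ x → trans (coeffAt-Σδ p x) (trans (eq x) (sym (coeffAt-Σδ r x)))

  coeffAt-++ : ∀ p r x → coeffAt (p ++ r) x ≈ coeffAt p x + coeffAt r x
  coeffAt-++ []            r x = sym (+-identityˡ _)
  coeffAt-++ ((b , i) ∷ p) r x = begin
    coeffAt ((b , i) ∷ p ++ r) x          ≈⟨ coeffAt-∷ b i (p ++ r) x ⟩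
    b * δ i x + coeffAt (p ++ r) x        ≈⟨ +-congˡ (coeffAt-++ p r x) ⟩
    b * δ i x + (coeffAt p x + coeffAt r x) ≈⟨ +-assoc _ _ _ ⟨
    b * δ i x + coeffAt p x + coeffAt r x ≈⟨ +-congʳ (coeffAt-∷ b i p x) ⟨
    coeffAt ((b , i) ∷ p) x + coeffAt r x ∎

  coeffAt-scale : ∀ a p x → coeffAt (scale a p) x ≈ a * coeffAt p x
  coeffAt-scale a []            x = sym (zeroʳ a)
  coeffAt-scale a ((b , i) ∷ p) x = begin
    coeffAt (scale a ((b , i) ∷ p)) x      ≈⟨ coeffAt-∷ (a * b) i (scale a p) x ⟩
    a * b * δ i x + coeffAt (scale a p) x  ≈⟨ +-cong (*-assoc a b (δ i x)) (coeffAt-scale a p x) ⟩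
    a * (b * δ i x) + a * coeffAt p x      ≈⟨ distribˡ a _ _ ⟨
    a * (b * δ i x + coeffAt p x)          ≈⟨ *-congˡ (coeffAt-∷ b i p x) ⟨
    a * coeffAt ((b , i) ∷ p) x            ∎

  reindex : (Index → Index) → Poly → Poly
  reindex g = map (λ { (b , i) → (b , g i) })

  coeffAt-reindex : ∀ {g} → Injective _≡_ _≡_ g → ∀ p x → coeffAt (reindex g p) (g x) ≈ coeffAt p x
  coeffAt-reindex     g-inj []            x = refl
  coeffAt-reindex {g} g-inj ((b , i) ∷ p) x = begin
    coeffAt ((b , g i) ∷ reindex g p) (g x)          ≈⟨ coeffAt-∷ b (g i) (reindex g p) (g x) ⟩
    b * δ (g i) (g x) + coeffAt (reindex g p) (g x)  ≈⟨ +-cong (*-congˡ (reflexive (δ-injective g-inj i x)))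
                                                               (coeffAt-reindex g-inj p x) ⟩
    b * δ i x + coeffAt p x                          ≈⟨ coeffAt-∷ b i p x ⟨
    coeffAt ((b , i) ∷ p) x                          ∎

  coeffAt-reindex-∉ : ∀ {g} p x → (∀ i → g i ≢ x) → coeffAt (reindex g p) x ≈ 0#
  coeffAt-reindex-∉     []            x x∉g = refl
  coeffAt-reindex-∉ {g} ((b , i) ∷ p) x x∉g = begin
    coeffAt ((b , g i) ∷ reindex g p) x      ≈⟨ coeffAt-∷ b (g i) (reindex g p) x ⟩
    b * δ (g i) x + coeffAt (reindex g p) x  ≈⟨ +-cong (*-congˡ (reflexive (δ-≢ (x∉g i)))) (coeffAt-reindex-∉ p x x∉g) ⟩
    b * 0# + 0#                              ≈⟨ +-identityʳ _ ⟩
    b * 0#                                   ≈⟨ zeroʳ b ⟩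
    0#                                       ∎

  ImageDecidable : (Index → Index) → Set
  ImageDecidable g = ∀ x → (∃ λ i → g i ≡ x) ⊎ (∀ i → g i ≢ x)

  reindex-cong : ∀ {g p r} → Injective _≡_ _≡_ g → ImageDecidable g → p ≋ r → reindex g p ≋ reindex g r
  reindex-cong {g} {p} {r} g-inj g-image p≋r = mk≋ pointwise
    where
    pointwise : ∀ x → coeffAt (reindex g p) x ≈ coeffAt (reindex g r) x
    pointwise x with g-image x
    ... | inj₁ (i , ≡.refl) = trans (coeffAt-reindex g-inj p i) (trans (coeffAt-≈ p≋r i) (sym (coeffAt-reindex g-inj r i)))
    ... | inj₂ x∉g          = trans (coeffAt-reindex-∉ p x x∉g) (sym (coeffAt-reindex-∉ r x x∉g))

  shiftY : Index → Index
  shiftY (j , k) = (suc j , k)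

  shiftY-injective : Injective _≡_ _≡_ shiftY
  shiftY-injective {_ , _} {_ , _} ≡.refl = ≡.refl

  shiftY-image : ImageDecidable shiftY
  shiftY-image (zero  , k) = inj₂ λ { (_ , _) () }
  shiftY-image (suc j , k) = inj₁ ((j , k) , ≡.refl)

  shiftX : ℕ → Index → Index
  shiftX m (j , k) = (j , k +ℕ m)

  shiftX-injective : ∀ m → Injective _≡_ _≡_ (shiftX m)
  shiftX-injective m {j , k} {j' , k'} eq with ×-≡,≡←≡ eq
  ... | ≡.refl , k+m≡k'+m = ≡.cong (j ,_) (ℕₚ.+-cancelʳ-≡ m k k' k+m≡k'+m)

  shiftX-image : ∀ m → ImageDecidable (shiftX m)
  shiftX-image m (j , k) with m ≤? k
  ... | yes m≤k = inj₁ ((j , k ∸ m) , ≡.cong (j ,_) (ℕₚ.m∸n+n≡m m≤k))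
  ... | no  m≰k = inj₂ λ { (_ , k') eq → m≰k (≡.subst (m ≤_) (proj₂ (×-≡,≡←≡ eq)) (ℕₚ.m≤n+m m k')) }

  mulYˡ-cong : ∀ {p r} → p ≋ r → mulYˡ p ≋ mulYˡ r
  mulYˡ-cong = reindex-cong shiftY-injective shiftY-image

  mulXʳ-cong : ∀ m {p r} → p ≋ r → mulXʳ m p ≋ mulXʳ m r
  mulXʳ-cong m = reindex-cong (shiftX-injective m) (shiftX-image m)

  scale-cong : ∀ a {p r} → p ≋ r → scale a p ≋ scale a r
  scale-cong a {p} {r} p≋r = mk≋ λ x →
    trans (coeffAt-scale a p x) (trans (*-congˡ (coeffAt-≈ p≋r x)) (sym (coeffAt-scale a r x)))

  ++-congʳ : ∀ s {p r} → p ≋ r → p ++ s ≋ r ++ s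
  ++-congʳ s {p} {r} p≋r = mk≋ λ x →
    trans (coeffAt-++ p s x) (trans (+-congʳ (coeffAt-≈ p≋r x)) (sym (coeffAt-++ r s x)))

  XYpow-closed : ℕ → Poly
  XYpow-closed zero    = (1# , 0 , 1) ∷ []
  XYpow-closed (suc j) = (pow q (suc j) , suc j , 1) ∷ (μ * qint (suc j) , j , 0)
                           ∷ (ν * qint (suc j) , suc j , 0) ∷ []

  XYpow-closed-suc : ∀ j → scale q (mulYˡ (XYpow-closed j)) ++ (μ , j , 0) ∷ (ν , suc j , 0) ∷ []
                           ≋ XYpow-closed (suc j)
  XYpow-closed-suc zero = ≋-by-Σδ λ x →
    solve 6 (λ q μ ν d₁ d₂ d₃ →
               q :* con 1 :* d₁ :+ (μ :* d₂ :+ (ν :* d₃ :+ con 0))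
            := q :* con 1 :* d₁ :+ (μ :* (con 1 :+ q :* con 0) :* d₂ :+ (ν :* (con 1 :+ q :* con 0) :* d₃ :+ con 0)))
          refl q μ ν (δ (1 , 1) x) (δ (0 , 0) x) (δ (1 , 0) x)
  XYpow-closed-suc (suc j) = ≋-by-Σδ λ x →
    solve 8 (λ q P M μ ν d₁ d₂ d₃ →
               q :* P :* d₁ :+ (q :* (μ :* M) :* d₂ :+ (q :* (ν :* M) :* d₃ :+ (μ :* d₂ :+ (ν :* d₃ :+ con 0))))
            := q :* P :* d₁ :+ (μ :* (con 1 :+ q :* M) :* d₂ :+ (ν :* (con 1 :+ q :* M) :* d₃ :+ con 0)))
          refl q (pow q (suc j)) (qint (suc j)) μ ν
          (δ (suc (suc j) , 1) x) (δ (suc j , 0) x) (δ (suc (suc j) , 0) x)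

  XYpow≋XYpow-closed : ∀ j → XYpow j ≋ XYpow-closed j
  XYpow≋XYpow-closed zero    = mk≋ λ x → refl
  XYpow≋XYpow-closed (suc j) =
    ≋-trans (++-congʳ _ (scale-cong q (mulYˡ-cong (XYpow≋XYpow-closed j)))) (XYpow-closed-suc j)

  coeffAt-X-monomial : ∀ j k J K →
    coeffAt (mulXʳ k (XYpow j)) (J , K)
      ≈ pow q J * δ (j , suc k) (J , K) + μ * qint (suc J) * δ (j , k) (suc J , K)
        + ν * qint J * δ (j , k) (J , K)
  coeffAt-X-monomial j k J K = begin
    coeffAt (mulXʳ k (XYpow j)) (J , K)         ≈⟨ coeffAt-≈ (mulXʳ-cong k (XYpow≋XYpow-closed j)) (J , K) ⟩
    coeffAt (mulXʳ k (XYpow-closed j)) (J , K)  ≈⟨ coeffAt-Σδ (mulXʳ k (XYpow-closed j)) (J , K) ⟩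
    Σδ (mulXʳ k (XYpow-closed j)) (J , K)       ≈⟨ Σδ-closed j ⟩
    pow q j * δ (j , suc k) (J , K) + μ * qint j * δ (j , k) (suc J , K) + ν * qint j * δ (j , k) (J , K)
      ≈⟨ +-cong (+-cong (δ-transport (λ (j , _) → pow q j) (j , suc k) (J , K))
                        (δ-transport (λ (j , _) → μ * qint j) (j , k) (suc J , K)))
                (δ-transport (λ (j , _) → ν * qint j) (j , k) (J , K)) ⟩
    pow q J * δ (j , suc k) (J , K) + μ * qint (suc J) * δ (j , k) (suc J , K) + ν * qint J * δ (j , k) (J , K) ∎
    where
    Σδ-closed : ∀ j → Σδ (mulXʳ k (XYpow-closed j)) (J , K)
                    ≈ pow q j * δ (j , suc k) (J , K) + μ * qint j * δ (j , k) (suc J , K)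
                      + ν * qint j * δ (j , k) (J , K)
    Σδ-closed zero = solve 5 (λ μ ν d₁ d₂ d₃ →
                                con 1 :* d₁ :+ con 0 := con 1 :* d₁ :+ μ :* con 0 :* d₂ :+ ν :* con 0 :* d₃)
                              refl μ ν (δ (0 , suc k) (J , K)) (δ (0 , k) (suc J , K)) (δ (0 , k) (J , K))
    Σδ-closed (suc j) rewrite ≡.sym (δ-injective shiftY-injective (j , k) (J , K)) =
      solve 7 (λ P M μ ν d₁ d₂ d₃ →
                 P :* d₁ :+ (μ :* M :* d₂ :+ (ν :* M :* d₃ :+ con 0)) := P :* d₁ :+ μ :* M :* d₂ :+ ν :* M :* d₃)
              refl (pow q (suc j)) (qint (suc j)) μ ν
              (δ (suc j , suc k) (J , K)) (δ (suc j , k) (suc J , K)) (δ (suc j , k) (J , K))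

  coeffAt-mulXˡ : ∀ p J K →
    coeffAt (mulXˡ p) (J , K)
      ≈ pow q J * coeffAt (mulXʳ 1 p) (J , K) + μ * qint (suc J) * coeffAt p (suc J , K)
        + ν * qint J * coeffAt p (J , K)
  coeffAt-mulXˡ [] J K = solve 3 (λ A B C → con 0 := A :* con 0 :+ B :* con 0 :+ C :* con 0)
                                 refl (pow q J) (μ * qint (suc J)) (ν * qint J)
  coeffAt-mulXˡ ((b , j , k) ∷ p) J K = begin
    coeffAt (scale b (mulXʳ k (XYpow j)) ++ mulXˡ p) x
      ≈⟨ coeffAt-++ (scale b (mulXʳ k (XYpow j))) (mulXˡ p) x ⟩
    coeffAt (scale b (mulXʳ k (XYpow j))) x + coeffAt (mulXˡ p) x
      ≈⟨ +-cong (trans (coeffAt-scale b (mulXʳ k (XYpow j)) x) (*-congˡ (coeffAt-X-monomial j k J K)))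
                (coeffAt-mulXˡ p J K) ⟩
    b * (A * δ (j , suc k) x + B * δ (j , k) x⁺ + C * δ (j , k) x)
      + (A * coeffAt (mulXʳ 1 p) x + B * coeffAt p x⁺ + C * coeffAt p x)
      ≈⟨ regroup b A B C (δ (j , suc k) x) (δ (j , k) x⁺) (δ (j , k) x)
                 (coeffAt (mulXʳ 1 p) x) (coeffAt p x⁺) (coeffAt p x) ⟩
    A * (b * δ (j , suc k) x + coeffAt (mulXʳ 1 p) x) + B * (b * δ (j , k) x⁺ + coeffAt p x⁺)
      + C * (b * δ (j , k) x + coeffAt p x)
      ≈⟨ +-cong (+-cong (*-congˡ (sym coeffAt-mulXʳ-∷)) (*-congˡ (sym (coeffAt-∷ b (j , k) p x⁺))))
                (*-congˡ (sym (coeffAt-∷ b (j , k) p x))) ⟩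
    A * coeffAt (mulXʳ 1 ((b , j , k) ∷ p)) x + B * coeffAt ((b , j , k) ∷ p) x⁺
      + C * coeffAt ((b , j , k) ∷ p) x ∎
    where
    x x⁺ : Index
    x  = (J , K)
    x⁺ = (suc J , K)
    A B C : Carrier
    A = pow q J
    B = μ * qint (suc J)
    C = ν * qint J
    coeffAt-mulXʳ-∷ : coeffAt (mulXʳ 1 ((b , j , k) ∷ p)) x ≈ b * δ (j , suc k) x + coeffAt (mulXʳ 1 p) x
    coeffAt-mulXʳ-∷ = trans (coeffAt-∷ b (j , k +ℕ 1) (mulXʳ 1 p) x)
                            (+-congʳ (*-congˡ (reflexive (≡.cong (λ k′ → δ (j , k′) x) (ℕₚ.+-comm k 1)))))
    regroup : ∀ b A B C d₁ d₂ d₃ c₁ c₂ c₃ →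
      b * (A * d₁ + B * d₂ + C * d₃) + (A * c₁ + B * c₂ + C * c₃)
        ≈ A * (b * d₁ + c₁) + B * (b * d₂ + c₂) + C * (b * d₃ + c₃)
    regroup = solve 10 (λ b A B C d₁ d₂ d₃ c₁ c₂ c₃ →
                          b :* (A :* d₁ :+ B :* d₂ :+ C :* d₃) :+ (A :* c₁ :+ B :* c₂ :+ C :* c₃)
                       := A :* (b :* d₁ :+ c₁) :+ B :* (b :* d₂ :+ c₂) :+ C :* (b :* d₃ :+ c₃)) refl

  coeffAt-mulXʳ-YXpow : ∀ n j k → coeffAt (mulXʳ 1 (YXpow n)) (j , k) ≈ S n (+ j) (+ k -ℤ + 1)
  coeffAt-mulXʳ-YXpow n j zero    = coeffAt-reindex-∉ (YXpow n) (j , 0) λ { (_ , k) eq → ℕₚ.m+1+n≢0 k (proj₂ (×-≡,≡←≡ eq)) }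
  coeffAt-mulXʳ-YXpow n j (suc k) =
    ≡.subst (λ k′ → coeffAt (mulXʳ 1 (YXpow n)) (j , k′) ≈ coeff (YXpow n) j k) (ℕₚ.+-comm k 1)
            (coeffAt-reindex (shiftX-injective 1) (YXpow n) (j , k))

proposition2p13 : ∀ {c ℓ} (R : CommutativeRing c ℓ) (μ ν q : CommutativeRing.Carrier R)
    → let open CommutativeRing R
          open NormalOrder R μ ν q
      in ∀ (n j k : ℕ) → 1 ≤ j →
         S (suc n) (+ j) (+ k)
           ≈ pow q (j ∸ 1) * S n (+ j -ℤ + 1) (+ k -ℤ + 1)
             + μ * qint j * S n (+ j) (+ k)
             + ν * qint (j ∸ 1) * S n (+ j -ℤ + 1) (+ k)
proposition2p13 R μ ν q n (suc j) k (s≤s _) = begin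
  coeffAt (mulYˡ (mulXˡ P)) (suc j , k)  ≈⟨ coeffAt-reindex shiftY-injective (mulXˡ P) (j , k) ⟩
  coeffAt (mulXˡ P) (j , k)              ≈⟨ coeffAt-mulXˡ P j k ⟩
  pow q j * coeffAt (mulXʳ 1 P) (j , k) + μ * qint (suc j) * S n (+ suc j) (+ k) + ν * qint j * S n (+ j) (+ k)
    ≈⟨ +-congʳ (+-congʳ (*-congˡ (coeffAt-mulXʳ-YXpow n j k))) ⟩
  pow q j * S n (+ j) (+ k -ℤ + 1) + μ * qint (suc j) * S n (+ suc j) (+ k) + ν * qint j * S n (+ j) (+ k) ∎
  where
  open CommutativeRing R
  open NormalOrder R μ ν q
  open NormalOrderProperties R μ ν q
  open import Relation.Binary.Reasoning.Setoid setoid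
  P : Poly
  P = YXpow n
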